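{- For every signature $\Sigma$, label set $L$ and set $\mathcal{R}$ of De Simone rules, the family $\rho_X\colon\Sigma(X+L\times X+1)\to\mathcal{P}(L\times\Sigma^{\star}X+1)$ induced by $\mathcal{R}$ (as described in the context) is a De Simone law, i.e. for every set $X$ it satisfies $\rho_X\cdot\bar\Sigma\bar B_0 i_X=\bar B\overline{\Sigma^{\star}}i_X\cdot\rho_{\mathcal{P}_+X}$ in $\mathrm{Kl}(\mathcal{P})$, where $i_X\colon\mathcal{P}_+X\to\mathcal{P}X$ is the inclusion of the set of nonempty subsets.
   Context: A signature $\Sigma$ is a set of operation symbols with arities; it also denotes the polynomial functor $\Sigma X=\coprod_{f\in\Sigma}X^{\mathrm{ar}(f)}$ on sets, and $\Sigma^{\star}X$ is the set of $\Sigma$-terms over variables from $X$. Fix a set $L$ of labels and variables $x_i,y_i$ ($i\in\mathbb{N}$). A De Simone rule has the form: premises $x_{i_1}\xrightarrow{a_1}y_{i_1},\dots,x_{i_k}\xrightarrow{a_k}y_{i_k}$ and conclusion $f(x_1,\dots,x_n)\xrightarrow{a}t$, where $f\in\Sigma$ is $n$-ary, $i_1,\dots,i_k\in\{1,\dots,n\}$ are pairwise distinct, $a_1,\dots,a_k,a\in L$, and $t$ is an affine $\Sigma$-term (no variable occurs more than once) in the variables $y_i$ ($i\in\{i_1,\dots,i_k\}$) and $x_j$ ($j\notin\{i_1,\dots,i_k\}$). The induced $\rho_X$ maps $f(u_1,\dots,u_n)$ to $\{*\}$ if some $u_i=*$; otherwise, letting $\{i_1,\dots,i_k\}=\{i: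 u_i\in L\times X\}$ with $u_{i_l}=(a_l,v_{i_l})$, it maps it to the set consisting of $*$ together with all pairs $(a,t[\sigma])$ such that $\mathcal{R}$ contains a rule with premises $x_{i_l}\xrightarrow{a_l}y_{i_l}$ ($l=1,\dots,k$) and conclusion $f(x_1,\dots,x_n)\xrightarrow{a}t$, where $\sigma$ is $y_{i_l}\mapsto v_{i_l}$ and $x_j\mapsto u_j$ for $j\notin\{i_1,\dots,i_k\}$. Kleisli category of the powerset monad $\mathcal{P}$: morphisms $X\rightsquigarrow Y$ are maps $X\to\mathcal{P}Y$, composition $(g\cdot f)(x)=\bigcup_{y\in f(x)}g(y)$. Let $BX=L\times X+1$ and $B_0X=X+L\times X+1$. Distributive laws: $\delta^B\colon L\times\mathcal{P}X+1\to\mathcal{P}(L\times X+1)$, $(a,S)\mapsto\{(a,s):s\in S\}$, $*\mapsto\{*\}$; $\delta^{B_0}\colon\mathcal{P}X+L\times\mathcal{P}X+1\to\mathcal{P}(X+L\times X+1)$, $S\mapsto S$, $(a,S)\mapsto\{(a,s):s\in S\}$, $*\mapsto\{*\}$; $\delta^{\Sigma}\colon\Sigma\mathcal{P}X\to\mathcal{P}\Sigma X$, $f(S_1,\dots,S_n)\mapsto\{f(s_1,\dots,s_n):s_i\in S_i\}$; $\delta^{\Sigma^{\star}}\colon\Sigma^{\star}\mathcal{P}X\to\mathcal{P}\Sigma^{\star}X$ maps a term whose variables are subsets of $X$ to the set of all terms obtained by replacing each occurrence of each variable $U$ by some element of $U$, independently for each occurrence. For $f\colon X\to\mathcal{P}Y$: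 $\bar\Sigma f=\delta^{\Sigma}\circ\Sigma f$, $\bar B_0f=\delta^{B_0}\circ B_0f$, $\bar B\overline{\Sigma^{\star}}f=\delta^B\circ B(\delta^{\Sigma^{\star}}\circ\Sigma^{\star}f)$ (here $\Sigma f$, $B_0f$, $\Sigma^{\star}f$ denote the functorial actions on the function $f$). -}

module Defs where

open import Level using (Level; _⊔_; suc; Lift; lift)
open import Data.Nat using (ℕ)
open import Data.Fin using (Fin)
open import Data.Vec using (Vec; []; _∷_; lookup)
import Data.Vec as Vec
open import Data.List using (List; []; _++_; [_])
open import Data.List.Relation.Unary.Unique.Propositional using (Unique)
open import Data.Maybe using (Maybe; just; nothing)
import Data.Maybe as Maybe
open import Data.Product using (Σ; _×_; _,_; proj₁; proj₂; ∃)
open import Data.Sum using (_⊎_; inj₁; inj₂)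
open import Data.Unit using (⊤; tt)
open import Data.Empty using (⊥)
open import Relation.Binary.PropositionalEquality using (_≡_; subst; sym)

private
  variable
    a b c ℓ : Level

record Signature : Set₁ where
  field
    Op : Set
    ar : Op → ℕ
open Signature public

⟦_⟧ : Signature → Set ℓ → Set ℓ
⟦ Sig ⟧ X = Σ (Op Sig) (λ f → Vec X (ar Sig f))

⟦_⟧map : (Sig : Signature) {X : Set a} {Y : Set b} → (X → Y) → ⟦ Sig ⟧ X → ⟦ Sig ⟧ Y
⟦ Sig ⟧map g (f , xs) = f , Vec.map g xs

data Term (Sig : Signature) (X : Set ℓ) : Set ℓ where
  var : X → Term Sig X
  op  : (f : Op Sig) → Vec (Term Sig X) (ar Sig f) → Term Sig X

module _ {Sig : Signature} where
  mutual
    tmap : {X : Set a} {Y : Set b} → (X → Y) → Term Sig X → Term Sig Y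
    tmap g (var x) = var (g x)
    tmap g (op f ts) = op f (tmaps g ts)

    tmaps : ∀ {n} {X : Set a} {Y : Set b} → (X → Y) → Vec (Term Sig X) n → Vec (Term Sig Y) n
    tmaps g [] = []
    tmaps g (t ∷ ts) = tmap g t ∷ tmaps g ts

  mutual
    vars : {X : Set a} → Term Sig X → List X
    vars (var x) = [ x ]
    vars (op f ts) = varss ts

    varss : ∀ {n} {X : Set a} → Vec (Term Sig X) n → List X
    varss [] = []
    varss (t ∷ ts) = vars t ++ varss ts

Affine : {Sig : Signature} {X : Set a} → Term Sig X → Set a
Affine t = Unique (vars t)

P : Set ℓ → Set (suc ℓ)
P {ℓ} X = X → Set ℓ

P₊ : Set ℓ → Set (suc ℓ)
P₊ X = Σ (P X) (λ S → ∃ λ x → S x)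

incl : (X : Set ℓ) → P₊ X → P X
incl X = proj₁

_·_ : {X : Set a} {Y : Set b} {Z : Set c} →
      (Y → Z → Set c) → (X → Y → Set b) → X → Z → Set (b ⊔ c)
(g · f) x z = Σ _ (λ y → f x y × g y z)

B : Set → Set ℓ → Set ℓ
B L X = (L × X) ⊎ ⊤

B₀ : Set → Set ℓ → Set ℓ
B₀ L X = X ⊎ ((L × X) ⊎ ⊤)

Bmap : (L : Set) {X : Set a} {Y : Set b} → (X → Y) → B L X → B L Y
Bmap L g (inj₁ (l , x)) = inj₁ (l , g x)
Bmap L g (inj₂ tt) = inj₂ tt

B₀map : (L : Set) {X : Set a} {Y : Set b} → (X → Y) → B₀ L X → B₀ L Y
B₀map L g (inj₁ x) = inj₁ (g x)
B₀map L g (inj₂ (inj₁ (l , x))) = inj₂ (inj₁ (l , g x))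
B₀map L g (inj₂ (inj₂ tt)) = inj₂ (inj₂ tt)

δB : (L : Set) {X : Set ℓ} → B L (P X) → P (B L X)
δB L (inj₁ (l , S)) (inj₁ (l' , x)) = (l ≡ l') × S x
δB L (inj₁ _) (inj₂ _) = Lift _ ⊥
δB L (inj₂ _) (inj₁ _) = Lift _ ⊥
δB L (inj₂ tt) (inj₂ tt) = Lift _ ⊤

δB₀ : (L : Set) {X : Set ℓ} → B₀ L (P X) → P (B₀ L X)
δB₀ L (inj₁ S) (inj₁ x) = S x
δB₀ L (inj₂ (inj₁ (l , S))) (inj₂ (inj₁ (l' , x))) = (l ≡ l') × S x
δB₀ L (inj₂ (inj₂ tt)) (inj₂ (inj₂ tt)) = Lift _ ⊤
δB₀ L (inj₁ _) (inj₂ _) = Lift _ ⊥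
δB₀ L (inj₂ _) (inj₁ _) = Lift _ ⊥
δB₀ L (inj₂ (inj₁ _)) (inj₂ (inj₂ _)) = Lift _ ⊥
δB₀ L (inj₂ (inj₂ _)) (inj₂ (inj₁ _)) = Lift _ ⊥

castV : {Sig : Signature} {X : Set ℓ} {f g : Op Sig} →
        f ≡ g → Vec X (ar Sig g) → Vec X (ar Sig f)
castV {Sig = Sig} {X = X} e = subst (λ h → Vec X (ar Sig h)) (sym e)

δΣ : (Sig : Signature) {X : Set ℓ} → ⟦ Sig ⟧ (P X) → P (⟦ Sig ⟧ X)
δΣ Sig (f , Ss) (g , xs) =
  Σ (f ≡ g) (λ e → (i : Fin (ar Sig f)) → lookup Ss i (lookup (castV e xs) i))

-- δ^{Σ⋆} : Σ⋆ P X → P Σ⋆ X  (independent choice at each occurrence)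
module _ {Sig : Signature} {X : Set ℓ} where
  mutual
    δΣ⋆ : Term Sig (P X) → P (Term Sig X)
    δΣ⋆ (var S) (var x) = S x
    δΣ⋆ (var S) (op _ _) = Lift _ ⊥
    δΣ⋆ (op f ts) (var _) = Lift _ ⊥
    δΣ⋆ (op f ts) (op g ss) = Σ (f ≡ g) (λ e → δΣ⋆s ts (castV e ss))

    δΣ⋆s : ∀ {n} → Vec (Term Sig (P X)) n → Vec (Term Sig X) n → Set ℓ
    δΣ⋆s [] [] = Lift _ ⊤
    δΣ⋆s (t ∷ ts) (s ∷ ss) = δΣ⋆ t s × δΣ⋆s ts ss

Σ̄ : (Sig : Signature) {X : Set a} {Y : Set ℓ} → (X → P Y) → ⟦ Sig ⟧ X → P (⟦ Sig ⟧ Y)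
Σ̄ Sig g u = δΣ Sig (⟦ Sig ⟧map g u)

B̄₀ : (L : Set) {X : Set a} {Y : Set ℓ} → (X → P Y) → B₀ L X → P (B₀ L Y)
B̄₀ L g u = δB₀ L (B₀map L g u)

B̄Σ̄⋆ : (Sig : Signature) (L : Set) {X : Set a} {Y : Set ℓ} →
       (X → P Y) → B L (Term Sig X) → P (B L (Term Sig Y))
B̄Σ̄⋆ Sig L g u = δB L (Bmap L (λ t → δΣ⋆ (tmap g t)) u)

-- A rule for the n-ary operation f (n = ar f) is encoded as follows:
--  * prem i = just a  means the premise  x_i --a--> y_i  is present,
--    prem i = nothing means there is no premise on x_i
--    (so the premise indices are automatically pairwise distinct);
--  * label is the label a of the conclusion f(x_1..x_n) --a--> target;
--  * target is a term whose variables are indices i : Fin n, where the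
--    variable i stands for y_i if prem i = just _, and for x_i otherwise;
--  * target is affine.

record Rule (Sig : Signature) (L : Set) (f : Op Sig) : Set where
  field
    prem   : Fin (ar Sig f) → Maybe L
    label  : L
    target : Term Sig (Fin (ar Sig f))
    affine : Affine target
open Rule public

RuleSet : Signature → Set → Set₁
RuleSet Sig L = (f : Op Sig) → Rule Sig L f → Set

classify : {L : Set} {X : Set ℓ} {n : ℕ} → Vec (B₀ L X) n → Maybe (Vec (Maybe L × X) n)
classify [] = just []
classify (inj₁ x ∷ us) = Maybe.map ((nothing , x) ∷_) (classify us)
classify (inj₂ (inj₁ (l , v)) ∷ us) = Maybe.map ((just l , v) ∷_) (classify us)
classify (inj₂ (inj₂ tt) ∷ us) = nothing

ρ-aux : (Sig : Signature) (L : Set) (ℛ : RuleSet Sig L) {X : Set ℓ} (f : Op Sig) →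
        Maybe (Vec (Maybe L × X) (ar Sig f)) → P (B L (Term Sig X))
ρ-aux Sig L ℛ f nothing z = z ≡ inj₂ tt
ρ-aux Sig L ℛ f (just w) (inj₂ tt) = Lift _ ⊤
ρ-aux Sig L ℛ f (just w) (inj₁ (l , s)) =
  Σ (Rule Sig L f) (λ r →
    ℛ f r
    × ((i : Fin (ar Sig f)) → prem r i ≡ proj₁ (lookup w i))
    × label r ≡ l
    × tmap (λ i → proj₂ (lookup w i)) (target r) ≡ s)

ρ : (Sig : Signature) (L : Set) (ℛ : RuleSet Sig L) (X : Set ℓ) →
    ⟦ Sig ⟧ (B₀ L X) → P (B L (Term Sig X))
ρ Sig L ℛ X (f , us) = ρ-aux Sig L ℛ f (classify us)

{-# OPTIONS --safe #-}
-- Both composites fire the same De Simone rules: whether a rule applies depends only on the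
-- labels of the arguments and on none of them being ∗, and choosing elements of the nonempty
-- argument sets changes neither. Choosing before firing instantiates the target with one
-- element per argument, firing before choosing allows an independent choice at every
-- occurrence of a variable in the target. These agree because the target is affine, so the
-- occurrence-wise choices glue to one choice per argument; nonemptiness supplies the arguments
-- not occurring in the target, and makes ∗ reachable on the left.
module Submission where

open import Defs
open import Level using (Level; lift)
open import Function using (_∘_)
open import Function.Bundles using (_⇔_; mk⇔)
open import Data.Nat using (ℕ)
import Data.Fin.Properties as Fin
open import Data.Vec using (Vec; []; _∷_; lookup; tabulate)
import Data.Vec as Vec
open import Data.Vec.Properties using (lookup-map; lookup∘tabulate)
open import Data.Vec.Relation.Binary.Pointwise.Inductive as Pointwise using (Pointwise; []; _∷_)
open import Data.Vec.Relation.Binary.Pointwise.Extensional using (ext; extensional⇒inductive)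
open import Data.List using (List; []; _∷_; _++_; [_])
import Data.List.Relation.Unary.All as All
import Data.List.Relation.Unary.All.Properties as Allₚ
open import Data.List.Relation.Unary.AllPairs using ([]; _∷_)
open import Data.List.Relation.Unary.Unique.Propositional using (Unique)
open import Data.List.Relation.Binary.Disjoint.Propositional using (Disjoint)
open import Data.List.Relation.Unary.Any using (here; there)
open import Data.List.Membership.Propositional using (_∈_; _∉_)
open import Data.List.Membership.Propositional.Properties using (∈-++⁺ˡ; ∈-++⁺ʳ)
open import Data.Maybe using (Maybe; just; nothing)
open import Data.Product using (_×_; _,_; proj₁; proj₂; ∃)
open import Data.Sum using (inj₁; inj₂)
open import Data.Unit using (tt)
open import Relation.Nullary using (yes; no; contradiction)
open import Relation.Binary.Definitions using (DecidableEquality)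
open import Relation.Binary.PropositionalEquality using (_≡_; refl; sym; trans; cong; cong₂; subst)

private
  variable
    a b ℓ : Level
    n : ℕ

Unique-++⁻ : {A : Set a} (xs : List A) {ys : List A} →
             Unique (xs ++ ys) → Unique xs × Unique ys × Disjoint xs ys
Unique-++⁻ []       u        = [] , u , λ ()
Unique-++⁻ (x ∷ xs) (x∉ ∷ u) with Unique-++⁻ xs u
... | uxs , uys , xs#ys = Allₚ.++⁻ˡ xs x∉ ∷ uxs , uys , disjoint
  where
  disjoint : Disjoint (x ∷ xs) _
  disjoint (here refl , v∈ys) = All.lookup (Allₚ.++⁻ʳ xs x∉) v∈ys refl
  disjoint (there v∈xs , v∈ys) = xs#ys (v∈xs , v∈ys)

pointwise-choice : {A : Set a} {B : Set b} {R : A → B → Set ℓ} →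
                   (∀ x → ∃ (R x)) → (xs : Vec A n) → ∃ λ (ys : Vec B n) → Pointwise R xs ys
pointwise-choice pick []       = [] , []
pointwise-choice pick (x ∷ xs) with pick x | pointwise-choice pick xs
... | y , xRy | ys , xsRys = y ∷ ys , xRy ∷ xsRys

module _ {A : Set a} (_≟_ : DecidableEquality A) {X : Set b} where
  open import Data.List.Membership.DecPropositional _≟_ using (_∈?_)

  piecewise : List A → (A → X) → (A → X) → A → X
  piecewise vs g h x with x ∈? vs
  ... | yes _ = g x
  ... | no  _ = h x

  module _ {vs : List A} {g h : A → X} {x : A} where

    piecewise-∈ : x ∈ vs → piecewise vs g h x ≡ g x
    piecewise-∈ x∈vs with x ∈? vs
    ... | yes _   = refl
    ... | no x∉vs = contradiction x∈vs x∉vs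

    piecewise-∉ : x ∉ vs → piecewise vs g h x ≡ h x
    piecewise-∉ x∉vs with x ∈? vs
    ... | yes x∈vs = contradiction x∈vs x∉vs
    ... | no  _    = refl

  piecewise-selects : {R : A → X → Set ℓ} {vs : List A} {g h : A → X} →
                      (∀ x → x ∈ vs → R x (g x)) → (∀ x → R x (h x)) →
                      ∀ x → R x (piecewise vs g h x)
  piecewise-selects {vs = vs} Rg Rh x with x ∈? vs
  ... | yes x∈vs = Rg x x∈vs
  ... | no  _    = Rh x

module _ {Sig : Signature} where

  mutual
    tmap-∘ : {A : Set a} {Y : Set b} {X : Set ℓ} (g : Y → X) (h : A → Y) (t : Term Sig A) →
             tmap g (tmap h t) ≡ tmap (g ∘ h) t
    tmap-∘ g h (var x)   = refl
    tmap-∘ g h (op f ts) = cong (op f) (tmaps-∘ g h ts)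

    tmaps-∘ : {A : Set a} {Y : Set b} {X : Set ℓ} (g : Y → X) (h : A → Y) (ts : Vec (Term Sig A) n) →
              tmaps g (tmaps h ts) ≡ tmaps (g ∘ h) ts
    tmaps-∘ g h []       = refl
    tmaps-∘ g h (t ∷ ts) = cong₂ _∷_ (tmap-∘ g h t) (tmaps-∘ g h ts)

  mutual
    tmap-cong : {A : Set a} {X : Set b} (t : Term Sig A) {g h : A → X} →
                (∀ x → x ∈ vars t → g x ≡ h x) → tmap g t ≡ tmap h t
    tmap-cong (var x)   g≗h = cong var (g≗h x (here refl))
    tmap-cong (op f ts) g≗h = cong (op f) (tmaps-cong ts g≗h)

    tmaps-cong : {A : Set a} {X : Set b} (ts : Vec (Term Sig A) n) {g h : A → X} →
                 (∀ x → x ∈ varss ts → g x ≡ h x) → tmaps g ts ≡ tmaps h ts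
    tmaps-cong []       g≗h = refl
    tmaps-cong (t ∷ ts) g≗h =
      cong₂ _∷_ (tmap-cong t (λ x → g≗h x ∘ ∈-++⁺ˡ))
                (tmaps-cong ts (λ x → g≗h x ∘ ∈-++⁺ʳ (vars t)))

  module _ {A : Set a} {X : Set ℓ} {S : A → P X} {c : A → X} (c∈S : ∀ x → S x (c x)) where
    mutual
      δΣ⋆-tmap⁺ : (t : Term Sig A) → δΣ⋆ (tmap S t) (tmap c t)
      δΣ⋆-tmap⁺ (var x)   = c∈S x
      δΣ⋆-tmap⁺ (op f ts) = refl , δΣ⋆s-tmaps⁺ ts

      δΣ⋆s-tmaps⁺ : (ts : Vec (Term Sig A) n) → δΣ⋆s (tmaps S ts) (tmaps c ts)
      δΣ⋆s-tmaps⁺ []       = lift tt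
      δΣ⋆s-tmaps⁺ (t ∷ ts) = δΣ⋆-tmap⁺ t , δΣ⋆s-tmaps⁺ ts

  module _ {A : Set a} (_≟_ : DecidableEquality A) {X : Set ℓ} {S : A → P X}
           (nonempty : ∀ x → ∃ (S x)) where
    mutual
      δΣ⋆-tmap⁻ : (t : Term Sig A) → Affine t → {s : Term Sig X} → δΣ⋆ (tmap S t) s →
                  ∃ λ (c : A → X) → (∀ x → S x (c x)) × tmap c t ≡ s
      δΣ⋆-tmap⁻ (var x) _ {var y} y∈Sx =
        piecewise _≟_ [ x ] (λ _ → y) (proj₁ ∘ nonempty) ,
        piecewise-selects _≟_ {R = S} {vs = [ x ]} (λ { _ (here refl) → y∈Sx }) (proj₂ ∘ nonempty) ,
        cong var (piecewise-∈ _≟_ (here refl))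
      δΣ⋆-tmap⁻ (op f ts) affine {op .f ss} (refl , ss∈) with δΣ⋆s-tmaps⁻ ts affine ss∈
      ... | c , c∈S , ts[c]≡ss = c , c∈S , cong (op f) ts[c]≡ss

      δΣ⋆s-tmaps⁻ : (ts : Vec (Term Sig A) n) → Unique (varss ts) → {ss : Vec (Term Sig X) n} →
                    δΣ⋆s (tmaps S ts) ss →
                    ∃ λ (c : A → X) → (∀ x → S x (c x)) × tmaps c ts ≡ ss
      δΣ⋆s-tmaps⁻ [] _ {[]} _ = proj₁ ∘ nonempty , proj₂ ∘ nonempty , refl
      δΣ⋆s-tmaps⁻ (t ∷ ts) unique {s ∷ ss} (s∈ , ss∈)
        with Unique-++⁻ (vars t) unique
      ... | affine , unique′ , disjoint
        with δΣ⋆-tmap⁻ t affine s∈ | δΣ⋆s-tmaps⁻ ts unique′ ss∈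
      ... | c₁ , c₁∈S , t[c₁]≡s | c₂ , c₂∈S , ts[c₂]≡ss =
        c , piecewise-selects _≟_ {R = S} {vs = vars t} (λ x _ → c₁∈S x) c₂∈S ,
        cong₂ _∷_ (trans (tmap-cong t (λ x → piecewise-∈ _≟_)) t[c₁]≡s)
                  (trans (tmaps-cong ts (λ x x∈ts → piecewise-∉ _≟_ (λ x∈t → disjoint (x∈t , x∈ts))))
                         ts[c₂]≡ss)
        where
        c : A → X
        c = piecewise _≟_ (vars t) c₁ c₂

module _ {L : Set} where

  -- Maybe L × X is X + L × X, the part of B₀ L X other than ∗.
  toB₀ : {X : Set a} → Maybe L × X → B₀ L X
  toB₀ (nothing , x) = inj₁ x
  toB₀ (just l  , x) = inj₂ (inj₁ (l , x))

  classify-map-toB₀ : {X : Set a} (w : Vec (Maybe L × X) n) → classify (Vec.map toB₀ w) ≡ just w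
  classify-map-toB₀ []                 = refl
  classify-map-toB₀ ((nothing , x) ∷ w) rewrite classify-map-toB₀ w = refl
  classify-map-toB₀ ((just l  , x) ∷ w) rewrite classify-map-toB₀ w = refl

  map-toB₀-classify : {X : Set a} (us : Vec (B₀ L X) n) {w : Vec (Maybe L × X) n} →
                      classify us ≡ just w → Vec.map toB₀ w ≡ us
  map-toB₀-classify [] refl = refl
  map-toB₀-classify (inj₁ x ∷ us) eq with classify us in e | eq
  ... | just w | refl = cong (inj₁ x ∷_) (map-toB₀-classify us e)
  map-toB₀-classify (inj₂ (inj₁ (l , x)) ∷ us) eq with classify us in e | eq
  ... | just w | refl = cong (inj₂ (inj₁ (l , x)) ∷_) (map-toB₀-classify us e)
  map-toB₀-classify (inj₂ (inj₂ tt) ∷ us) ()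

  B̄₀-nonempty : {X : Set ℓ} (u : B₀ L (P₊ X)) → ∃ (B̄₀ L (incl X) u)
  B̄₀-nonempty (inj₁ (_ , x , x∈S))             = inj₁ x , x∈S
  B̄₀-nonempty (inj₂ (inj₁ (l , _ , x , x∈S))) = inj₂ (inj₁ (l , x)) , refl , x∈S
  B̄₀-nonempty (inj₂ (inj₂ tt))                 = inj₂ (inj₂ tt) , lift tt

  Chosen : {Y : Set a} {X : Set ℓ} → (Y → P X) → Maybe L × Y → Maybe L × X → Set ℓ
  Chosen g p q = proj₁ p ≡ proj₁ q × g (proj₂ p) (proj₂ q)

  module _ {Y : Set a} {X : Set ℓ} {g : Y → P X} where

    B̄₀-toB₀⁺ : {p : Maybe L × Y} {q : Maybe L × X} → Chosen g p q → B̄₀ L g (toB₀ p) (toB₀ q)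
    B̄₀-toB₀⁺ {p = nothing , _} (refl , x∈gy) = x∈gy
    B̄₀-toB₀⁺ {p = just _  , _} (refl , x∈gy) = refl , x∈gy

    B̄₀-toB₀⁻ : (u : B₀ L Y) {q : Maybe L × X} → B̄₀ L g u (toB₀ q) →
               ∃ λ p → toB₀ p ≡ u × Chosen g p q
    B̄₀-toB₀⁻ (inj₁ y)             {nothing , _} x∈gy          = (nothing , y) , refl , refl , x∈gy
    B̄₀-toB₀⁻ (inj₂ (inj₁ (l , y))) {just _  , _} (refl , x∈gy) = (just l , y) , refl , refl , x∈gy
    B̄₀-toB₀⁻ (inj₂ (inj₂ tt))       {nothing , _} (lift ())
    B̄₀-toB₀⁻ (inj₂ (inj₂ tt))       {just _  , _} (lift ())

    pointwise-B̄₀-map-toB₀⁻ : {us : Vec (B₀ L Y) n} (w′ : Vec (Maybe L × X) n) →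
                             Pointwise (B̄₀ L g) us (Vec.map toB₀ w′) →
                             ∃ λ w → Vec.map toB₀ w ≡ us × Pointwise (Chosen g) w w′
    pointwise-B̄₀-map-toB₀⁻ []       []                 = [] , refl , []
    pointwise-B̄₀-map-toB₀⁻ (q ∷ w′) (_∷_ {x = u} uq us) with B̄₀-toB₀⁻ u uq | pointwise-B̄₀-map-toB₀⁻ w′ us
    ... | p , refl , pq | w , refl , ww′ = p ∷ w , refl , pq ∷ ww′

module _ {Sig : Signature} {Y : Set a} {X : Set ℓ} {g : Y → P X} {f : Op Sig} {xs : Vec Y (ar Sig f)}
         {ys : Vec X (ar Sig f)} where

  Σ̄-pointwise⁺ : Pointwise g xs ys → Σ̄ Sig g (f , xs) (f , ys)
  Σ̄-pointwise⁺ xs∼ys = refl , λ i →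
    subst (λ G → G (lookup ys i)) (sym (lookup-map i g xs)) (Pointwise.lookup xs∼ys i)

  Σ̄-pointwise⁻ : Σ̄ Sig g (f , xs) (f , ys) → Pointwise g xs ys
  Σ̄-pointwise⁻ (refl , xs∼ys) = extensional⇒inductive (ext λ i →
    subst (λ G → G (lookup ys i)) (lookup-map i g xs) (xs∼ys i))

module _ (Sig : Signature) (L : Set) (ℛ : RuleSet Sig L) {f : Op Sig} where

  ρ-∗ : {Y : Set ℓ} (us : Vec (B₀ L Y) (ar Sig f)) → ρ Sig L ℛ Y (f , us) (inj₂ tt)
  ρ-∗ us with classify us
  ... | nothing = refl
  ... | just _  = lift tt

  module _ {Y : Set ℓ} {l : L} {s : Term Sig Y} where

    ρ-map-toB₀ : (w : Vec (Maybe L × Y) (ar Sig f)) →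
                 ρ-aux Sig L ℛ f (just w) (inj₁ (l , s)) → ρ Sig L ℛ Y (f , Vec.map toB₀ w) (inj₁ (l , s))
    ρ-map-toB₀ w fires rewrite classify-map-toB₀ w = fires

    ρ-inj₁⁻ : (us : Vec (B₀ L Y) (ar Sig f)) → ρ Sig L ℛ Y (f , us) (inj₁ (l , s)) →
              ∃ λ w → Vec.map toB₀ w ≡ us × ρ-aux Sig L ℛ f (just w) (inj₁ (l , s))
    ρ-inj₁⁻ us fires with classify us in eq
    ... | just w = w , map-toB₀-classify us eq , fires

  module _ {X : Set ℓ} {l : L} where

    ρ-aux-choose⁺ : {w : Vec (Maybe L × P₊ X) (ar Sig f)} {w′ : Vec (Maybe L × X) (ar Sig f)}
                    {s : Term Sig X} → Pointwise (Chosen (incl X)) w w′ →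
                    ρ-aux Sig L ℛ f (just w′) (inj₁ (l , s)) →
                    ∃ λ tw → ρ-aux Sig L ℛ f (just w) (inj₁ (l , tw)) × δΣ⋆ (tmap (incl X) tw) s
    ρ-aux-choose⁺ {w} ww′ (r , r∈ℛ , prem≡ , label≡ , refl) =
      tmap (proj₂ ∘ lookup w) (target r) ,
      (r , r∈ℛ , (λ i → trans (prem≡ i) (sym (proj₁ (Pointwise.lookup ww′ i)))) , label≡ , refl) ,
      subst (λ t → δΣ⋆ t _) (sym (tmap-∘ proj₁ (proj₂ ∘ lookup w) (target r)))
            (δΣ⋆-tmap⁺ (proj₂ ∘ Pointwise.lookup ww′) (target r))

    ρ-aux-choose⁻ : (w : Vec (Maybe L × P₊ X) (ar Sig f)) {tw : Term Sig (P₊ X)} {s : Term Sig X} →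
                    ρ-aux Sig L ℛ f (just w) (inj₁ (l , tw)) → δΣ⋆ (tmap (incl X) tw) s →
                    ∃ λ w′ → Pointwise (Chosen (incl X)) w w′ × ρ-aux Sig L ℛ f (just w′) (inj₁ (l , s))
    ρ-aux-choose⁻ w (r , r∈ℛ , prem≡ , label≡ , refl) s∈
      with c , c∈ , t[c]≡s ← δΣ⋆-tmap⁻ Fin._≟_ (proj₂ ∘ proj₂ ∘ lookup w) (target r) (affine r)
                               (subst (λ t → δΣ⋆ t _) (tmap-∘ proj₁ (proj₂ ∘ lookup w) (target r)) s∈)
      = w′ ,
        extensional⇒inductive (ext λ i →
          subst (Chosen (incl X) (lookup w i)) (sym (lookup-w′ i)) (refl , c∈ i)) ,
        r , r∈ℛ , (λ i → trans (prem≡ i) (cong proj₁ (sym (lookup-w′ i)))) , label≡ ,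
        trans (tmap-cong (target r) (λ i _ → cong proj₂ (lookup-w′ i))) t[c]≡s
      where
      w′ : Vec (Maybe L × X) (ar Sig f)
      w′ = tabulate (λ i → proj₁ (lookup w i) , c i)

      lookup-w′ : ∀ i → lookup w′ i ≡ (proj₁ (lookup w i) , c i)
      lookup-w′ = lookup∘tabulate _

proposition30 : (Sig : Signature) (L : Set) (ℛ : RuleSet Sig L) {ℓ : Level} (X : Set ℓ)
                (u : ⟦ Sig ⟧ (B₀ L (P₊ X))) (z : B L (Term Sig X)) →
                (ρ Sig L ℛ X · Σ̄ Sig (B̄₀ L (incl X))) u z
                  ⇔ (B̄Σ̄⋆ Sig L (incl X) · ρ Sig L ℛ (P₊ X)) u z
proposition30 Sig L ℛ X (f , us) z = mk⇔ (to z) (from z)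
  where
  to : ∀ z → (ρ Sig L ℛ X · Σ̄ Sig (B̄₀ L (incl X))) (f , us) z →
             (B̄Σ̄⋆ Sig L (incl X) · ρ Sig L ℛ (P₊ X)) (f , us) z
  to (inj₂ tt) _ = inj₂ tt , ρ-∗ Sig L ℛ us , lift tt
  to (inj₁ (l , s)) ((f , ys) , ys∈Σ̄us@(refl , _) , fires)
    with w′ , refl , fires′ ← ρ-inj₁⁻ Sig L ℛ ys fires
    with w , refl , ww′ ← pointwise-B̄₀-map-toB₀⁻ {us = us} w′ (Σ̄-pointwise⁻ ys∈Σ̄us)
    with tw , firesw , s∈tw ← ρ-aux-choose⁺ Sig L ℛ ww′ fires′
    = inj₁ (l , tw) , ρ-map-toB₀ Sig L ℛ w firesw , refl , s∈tw

  from : ∀ z → (B̄Σ̄⋆ Sig L (incl X) · ρ Sig L ℛ (P₊ X)) (f , us) z →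
               (ρ Sig L ℛ X · Σ̄ Sig (B̄₀ L (incl X))) (f , us) z
  from (inj₂ tt) _
    with ys , us∼ys ← pointwise-choice B̄₀-nonempty us
    = (f , ys) , Σ̄-pointwise⁺ us∼ys , ρ-∗ Sig L ℛ ys
  from (inj₁ (_ , s)) (inj₁ (l , tw) , fires , refl , s∈tw)
    with w , refl , firesw ← ρ-inj₁⁻ Sig L ℛ us fires
    with w′ , ww′ , fires′ ← ρ-aux-choose⁻ Sig L ℛ w firesw s∈tw
    = (f , Vec.map toB₀ w′) , Σ̄-pointwise⁺ (Pointwise.map⁺ B̄₀-toB₀⁺ ww′) ,
      ρ-map-toB₀ Sig L ℛ w′ fires′
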